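{- Let $\ell,k\ge1$ and $\vec s=(s_1,\dots,s_k)\in\mathbb{Z}_{\ge1}^k$ with $s_1>1$. Then there exist integers $m_i\ge1$ ($0\le i\le\ell$), integers $a_{i,j}\in\mathbb{Z}$ and vectors $\vec s_{i,j}\in\mathbb{Z}_{\ge1}^{k_{i,j}}$ ($k_{i,j}\ge1$) with first component greater than $1$ ($0\le i\le\ell$, $1\le j\le m_i$) such that: (1) in $\mathcal{H}^*_{\ge1}$, $$[\{1\}^\ell,\vec s]=\sum_{0\le i\le\ell}\ \sum_{1\le j\le m_i}a_{i,j}\,[\{1\}^i]*[\vec s_{i,j}];$$ (2) for every $\vec p=(p_1,\dots,p_\ell)\in\mathbb{Z}_{\ge0}^\ell$ and $\vec r\in\mathbb{Z}_{\ge0}^k$ there exist $\vec r_{i,j}\in\mathbb{Z}_{\ge0}^{k_{i,j}}$ such that, in $\mathcal{H}^*_{\mathfrak M}$, $$\begin{bmatrix}\{1\}^\ell,\ \vec s\\ \vec p,\ \vec r\end{bmatrix}=\sum_{0\le i\le\ell}\ \sum_{1\le j\le m_i}a_{i,j}\begin{bmatrix}\{1\}^i\\ p_1,\dots,p_i\end{bmatrix}*\begin{bmatrix}\vec s_{i,j}\\ \vec r_{i,j}\end{bmatrix}.$$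
   Context: For a commutative semigroup $(G,\cdot)$, the quasi-shuffle algebra $\mathcal{H}^*_G$ is the $\mathbb{Q}$-vector space with basis all words $g_1g_2\cdots g_n$ ($n\ge0$, $g_i\in G$, the empty word being the unit $1$), with bilinear product $*$ defined by $1*w=w*1=w$ and $(au)*(bv)=a(u*bv)+b(au*v)+(a\cdot b)(u*v)$ for letters $a,b\in G$ and words $u,v$. $\mathcal{H}^*_{\ge1}$ is the case $G=\mathbb{Z}_{\ge1}$ under addition; the word with letters $s_1,\dots,s_n$ is written $[s_1,\dots,s_n]$. $\mathcal{H}^*_{\mathfrak M}$ is the case $G=\mathfrak M=\mathbb{Z}\times\mathbb{Z}_{\ge0}$ under componentwise addition; the word with letters $(s_1,r_1),\dots,(s_n,r_n)$ is written as the two-row array $\begin{bmatrix}s_1,\dots,s_n\\ r_1,\dots,r_n\end{bmatrix}$. $\{1\}^i$ denotes $i$ consecutive entries $1$, and $[\{1\}^0]$ (resp. the array with empty rows) denotes the empty word $1$. -}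

module Defs where

open import Data.Nat using (ℕ; zero; suc; _<_; _≤_)
open import Data.Integer as ℤ using (ℤ)
open import Data.Rational as ℚ using (ℚ; 0ℚ; 1ℚ)
open import Data.Fin using (Fin)
open import Data.List using (List; []; _∷_; _++_; map; concatMap; replicate; zipWith; allFin)
open import Data.Product using (_×_; _,_)
open import Data.Empty using (⊥)
open import Relation.Binary.Definitions using (DecidableEquality)
open import Relation.Binary.PropositionalEquality using (_≡_)
open import Relation.Nullary using (yes; no)
import Data.Nat.Properties as ℕP
import Data.Integer.Properties as ℤP
import Data.Product.Properties as ×P
import Data.List.Properties

-- Elements are finite formal
-- ℚ-linear combinations of words, represented as lists of
-- (coefficient , word); two combinations are equal in H*_G iff they
-- have the same coefficient at every word (relation _≈_).

module QuasiShuffle {G : Set} (_·_ : G → G → G) (_≟_ : DecidableEquality G) where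

  Word : Set
  Word = List G

  Lin : Set
  Lin = List (ℚ × Word)

  ⟦_⟧ : Word → Lin
  ⟦ w ⟧ = (1ℚ , w) ∷ []

  _•_ : ℚ → Lin → Lin
  c • x = map (λ { (d , w) → (c ℚ.* d , w) }) x

  pre : G → Lin → Lin
  pre a x = map (λ { (d , w) → (d , a ∷ w) }) x

  qsh : Word → Word → Lin
  qsh [] v = ⟦ v ⟧
  qsh (a ∷ u) [] = ⟦ a ∷ u ⟧
  qsh (a ∷ u) (b ∷ v) =
    pre a (qsh u (b ∷ v)) ++ pre b (qsh (a ∷ u) v) ++ pre (a · b) (qsh u v)

  _*_ : Lin → Lin → Lin
  x * y = concatMap (λ { (c , u) → concatMap (λ { (d , v) → (c ℚ.* d) • qsh u v }) y }) x

  ΣFin : (n : ℕ) → (Fin n → Lin) → Lin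
  ΣFin n f = concatMap f (allFin n)

  coeff : Lin → Word → ℚ
  coeff [] w = 0ℚ
  coeff ((c , u) ∷ x) w with Data.List.Properties.≡-dec _≟_ u w
  ... | yes _ = c ℚ.+ coeff x w
  ... | no _ = coeff x w

  _≈_ : Lin → Lin → Set
  x ≈ y = ∀ w → coeff x w ≡ coeff y w



-- Letters are represented by
-- natural numbers; all words occurring are required (in the statement)
-- to have entries ≥ 1, and the positive words form a subalgebra.

module H≥1 = QuasiShuffle {ℕ} Data.Nat._+_ ℕP._≟_

_+M_ : ℤ × ℕ → ℤ × ℕ → ℤ × ℕ
(s , r) +M (s' , r') = (s ℤ.+ s' , r Data.Nat.+ r')

module HM = QuasiShuffle {ℤ × ℕ} _+M_ (×P.≡-dec ℤP._≟_ ℕP._≟_)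

-- the two-row array [ s ; r ] as a word in M (rows of equal length)
arr : List ℕ → List ℕ → List (ℤ × ℕ)
arr s r = zipWith (λ a b → (ℤ.+ a , b)) s r

ones : ℕ → List ℕ
ones n = replicate n 1

data AllPos : List ℕ → Set where
  []  : AllPos []
  _∷_ : ∀ {x xs} → 1 ≤ x → AllPos xs → AllPos (x ∷ xs)

HeadGt1 : List ℕ → Set
HeadGt1 [] = ⊥
HeadGt1 (x ∷ _) = 1 < x

ℤ→ℚ : ℤ → ℚ
ℤ→ℚ a = a ℚ./ 1

-- For words p, u the product p * u is p ++ u plus a sum of words
-- take i p ++ y with i < length p.  Solving for p ++ u and recursing on the
-- shorter prefixes writes p ++ u as an integer combination of products
-- [take i p] * [y]: a finite list of terms (i, c, y), computed by one program
-- for every commutative semigroup.  If u is admissible so is every y, since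
-- its first letter is b or a + b with b > 1.  Grouping the terms by i gives
-- part (1).  For part (2): the inclusion ℤ_{≥1} → ℤ and the projection M → ℤ
-- are homomorphisms and the expansion commutes with letterwise homomorphisms,
-- so the expansion of an array has the prefixes and coefficients of the
-- expansion of its top row, and its words are arrays over the ℕ-words.
module Submission where

open import Defs
open import Data.Nat as ℕ using (ℕ; zero; suc; _≤_; _<_; z≤n; s≤s)
import Data.Nat.Properties as ℕP
open import Data.Integer as ℤ using (ℤ)
import Data.Integer.Properties as ℤP
open import Data.Rational as ℚ using (ℚ; 0ℚ; 1ℚ)
import Data.Rational.Properties as ℚP
open import Data.Fin using (Fin; toℕ; cast) renaming (zero to fzero; suc to fsuc)
import Data.Fin.Properties as FinP
open import Data.Bool using (true; false; if_then_else_; T)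
open import Data.Unit using (tt)
open import Data.Product as Product using (Σ; _×_; _,_; proj₁; proj₂)
import Data.Product.Properties as ×P
open import Data.List
  using (List; []; _∷_; _++_; map; concatMap; length; take; lookup; tabulate; allFin)
open import Data.List.Properties
  using (map-++; map-∘; map-id; length-map; take-map; take-take; take-all; length-take;
         concatMap-cong; concatMap-map; map-concatMap; ++-identityʳ; ∷-injective;
         length-zipWith; length-replicate; ≡-dec)
open import Data.List.Relation.Unary.All as All using (All; []; _∷_)
import Data.List.Relation.Unary.All.Properties as AllP
open import Data.List.Membership.Propositional.Properties using (∈-lookup)
open import Data.List.Relation.Binary.Pointwise as Pointwise using (Pointwise; Pointwise-length)
open import Function using (_∘_)
open import Relation.Binary.Definitions using (DecidableEquality)
open import Relation.Binary.PropositionalEquality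
open import Relation.Nullary using (yes; no)
open import Algebra.Properties.Group ℚP.+-0-group using () renaming (⁻¹-involutive to ℚ-neg-involutive)
open import Algebra.Properties.CommutativeMonoid.Sum ℚP.+-0-commutativeMonoid
  using (sum-syntax; ∑-comm; sum-cong-≗; sum-replicate-zero)

sumList : {A : Set} → (A → ℚ) → List A → ℚ
sumList f [] = 0ℚ
sumList f (x ∷ xs) = f x ℚ.+ sumList f xs

sumList-++ : {A : Set} (f : A → ℚ) (xs ys : List A) → sumList f (xs ++ ys) ≡ sumList f xs ℚ.+ sumList f ys
sumList-++ f [] ys = sym (ℚP.+-identityˡ _)
sumList-++ f (x ∷ xs) ys = trans (cong (f x ℚ.+_) (sumList-++ f xs ys)) (sym (ℚP.+-assoc (f x) _ _))

sumList-map : {A B : Set} (f : B → ℚ) (g : A → B) (xs : List A) → sumList f (map g xs) ≡ sumList (f ∘ g) xs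
sumList-map f g [] = refl
sumList-map f g (x ∷ xs) = cong (f (g x) ℚ.+_) (sumList-map f g xs)

sumList-concatMap : {A B : Set} (f : B → ℚ) (g : A → List B) (xs : List A) →
                    sumList f (concatMap g xs) ≡ sumList (sumList f ∘ g) xs
sumList-concatMap f g [] = refl
sumList-concatMap f g (x ∷ xs) =
  trans (sumList-++ f (g x) (concatMap g xs)) (cong (sumList f (g x) ℚ.+_) (sumList-concatMap f g xs))

sumList-cong : {A : Set} {f g : A → ℚ} {xs : List A} → All (λ x → f x ≡ g x) xs → sumList f xs ≡ sumList g xs
sumList-cong [] = refl
sumList-cong (e ∷ es) = cong₂ ℚ._+_ e (sumList-cong es)

sumList-neg : {A : Set} (f : A → ℚ) (xs : List A) → sumList (ℚ.-_ ∘ f) xs ≡ ℚ.- sumList f xs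
sumList-neg f [] = refl
sumList-neg f (x ∷ xs) = trans (cong (ℚ.- f x ℚ.+_) (sumList-neg f xs)) (sym (ℚP.neg-distrib-+ (f x) _))

sumList-tabulate : {A : Set} (f : A → ℚ) {n : ℕ} (g : Fin n → A) → sumList f (tabulate g) ≡ ∑[ i < n ] f (g i)
sumList-tabulate f {zero} g = refl
sumList-tabulate f {suc n} g = cong (f (g fzero) ℚ.+_) (sumList-tabulate f (g ∘ fsuc))

sumList-lookup : {A : Set} (f : A → ℚ) (xs : List A) → sumList f xs ≡ ∑[ j < length xs ] f (lookup xs j)
sumList-lookup f [] = refl
sumList-lookup f (x ∷ xs) = cong (f x ℚ.+_) (sumList-lookup f xs)

sumList-lookup-cast : {A B : Set} (f : A → ℚ) (xs : List B) (ys : List A) (e : length xs ≡ length ys) →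
                      sumList f ys ≡ ∑[ j < length xs ] f (lookup ys (cast e j))
sumList-lookup-cast f [] [] e = refl
sumList-lookup-cast f (x ∷ xs) (y ∷ ys) e = cong (f y ℚ.+_) (sumList-lookup-cast f xs ys (ℕP.suc-injective e))

sum-delta : ∀ ℓ k (x : ℚ) → k ≤ ℓ → ∑[ i < suc ℓ ] (if k ℕ.≡ᵇ toℕ i then x else 0ℚ) ≡ x
sum-delta ℓ zero x _ = trans (cong (x ℚ.+_) (sum-replicate-zero ℓ)) (ℚP.+-identityʳ x)
sum-delta (suc ℓ) (suc k) x (s≤s k≤ℓ) = trans (ℚP.+-identityˡ _) (sum-delta ℓ k x k≤ℓ)

length-take-≤ : {A : Set} (i : ℕ) (p : List A) → length (take i p) ≤ i
length-take-≤ i p rewrite length-take i p = ℕP.m⊓n≤m i (length p)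

-- A term (i, c, y) of an expansion relative to a word p stands for
-- c · [take i p] * [y].
record Term (A : Set) : Set where
  constructor term
  field
    len  : ℕ
    coef : ℤ
    word : List A
open Term

negate : {A : Set} → Term A → Term A
negate (term i c y) = term i (ℤ.- c) y

mapTerm : {A B : Set} → (A → B) → Term A → Term B
mapTerm f (term i c y) = term i c (map f y)

shape : {A : Set} → Term A → ℕ × ℤ
shape t = len t , coef t

-- Distributing n terms over the prefix lengths i ≤ ℓ gives the coefficient
-- array a_{i,j}: slot 0 is a dummy with coefficient 0 (so every m_i ≥ 1),
-- slot j+1 carries the coefficient of term j if that term has prefix length i.
slotCoef : ∀ {ℓ n} → (Fin n → ℕ × ℤ) → Fin (suc ℓ) → Fin (suc n) → ℤ
slotCoef shapes i fzero = ℤ.+ 0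
slotCoef shapes i (fsuc j) = if proj₁ (shapes j) ℕ.≡ᵇ toℕ i then proj₂ (shapes j) else ℤ.+ 0

slotWord : ∀ {A n} → (Fin n → Term A) → List A → Fin (suc n) → List A
slotWord g d fzero = d
slotWord g d (fsuc j) = word (g j)

module Shuffle {G : Set} (_·_ : G → G → G) where

  Word : Set
  Word = List G

  shuffles      : Word → Word → List Word
  otherShuffles : Word → Word → List Word

  shuffles [] v = v ∷ []
  shuffles (a ∷ u) [] = (a ∷ u) ∷ []
  shuffles (a ∷ u) (b ∷ v) = map (a ∷_) (shuffles u (b ∷ v)) ++ otherShuffles (a ∷ u) (b ∷ v)

  otherShuffles (a ∷ u) (b ∷ v) = map (b ∷_) (shuffles (a ∷ u) v) ++ map ((a · b) ∷_) (shuffles u v)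
  otherShuffles _ _ = []

  splice : Word → ℕ × Word → Word
  splice p (i , y) = take i p ++ y

  -- The quasi-shuffles of p and u other than the concatenation p ++ u,
  -- each written as a proper prefix of p followed by a word y.
  corrections : Word → Word → List (ℕ × Word)
  corrections [] u = []
  corrections (a ∷ p) u =
    map (λ c → suc (proj₁ c) , proj₂ c) (corrections p u) ++ map (0 ,_) (otherShuffles (a ∷ p) u)

  corrections-[] : ∀ p → corrections p [] ≡ []
  corrections-[] [] = refl
  corrections-[] (a ∷ p) rewrite corrections-[] p = refl

  shuffles-decompose : ∀ p u → shuffles p u ≡ (p ++ u) ∷ map (splice p) (corrections p u)
  shuffles-decompose [] u = refl
  shuffles-decompose (a ∷ p) [] rewrite corrections-[] p | ++-identityʳ p = refl
  shuffles-decompose (a ∷ p) (b ∷ v) rewrite shuffles-decompose p (b ∷ v) =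
    cong ((a ∷ p ++ b ∷ v) ∷_) (begin
      map (a ∷_) (map (splice p) C) ++ O
        ≡⟨ cong₂ _++_ (trans (sym (map-∘ C)) (map-∘ C)) (trans (sym (map-id O)) (map-∘ O)) ⟩
      map (splice (a ∷ p)) (map _ C) ++ map (splice (a ∷ p)) (map (0 ,_) O)
        ≡⟨ map-++ (splice (a ∷ p)) (map _ C) (map (0 ,_) O) ⟨
      map (splice (a ∷ p)) (corrections (a ∷ p) (b ∷ v)) ∎)
    where
    open ≡-Reasoning
    C : List (ℕ × Word)
    C = corrections p (b ∷ v)
    O : List Word
    O = otherShuffles (a ∷ p) (b ∷ v)

  corrections-bounded : ∀ p u → All (λ c → proj₁ c < length p) (corrections p u)
  corrections-bounded [] u = []
  corrections-bounded (a ∷ p) u =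
    AllP.++⁺ (AllP.map⁺ (All.map s≤s (corrections-bounded p u)))
             (AllP.map⁺ (All.universal (λ _ → s≤s z≤n) _))

  -- The expansion of the word p ++ u as Σ coef · (take len p) * word:
  -- p ++ u = p * u − Σ_{(i , y)} (take i p ++ y), and each take i p ++ y
  -- is expanded recursively; the fuel n only has to exceed length p.
  expand : ℕ → Word → Word → List (Term G)
  expand zero p u = []
  expand (suc n) p u =
    term (length p) (ℤ.+ 1) u ∷
    concatMap (λ c → map negate (expand n (take (proj₁ c) p) (proj₂ c))) (corrections p u)

  expand-bounded : ∀ n p u → All (λ t → len t ≤ length p) (expand n p u)
  expand-bounded zero p u = []
  expand-bounded (suc n) p u = ℕP.≤-refl ∷
    AllP.concat⁺ (AllP.map⁺ (All.map bounded (corrections-bounded p u)))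
    where
    bounded : ∀ {c} → proj₁ c < length p →
              All (λ t → len t ≤ length p) (map negate (expand n (take (proj₁ c) p) (proj₂ c)))
    bounded {i , y} i<p = AllP.map⁺ (All.map
      (λ t≤ → ℕP.≤-trans t≤ (ℕP.≤-trans (length-take-≤ i p) (ℕP.<⇒≤ i<p)))
      (expand-bounded n (take i p) y))

module Naturality {G H : Set} (_·_ : G → G → G) (_∙_ : H → H → H) (f : G → H)
                  (hom : ∀ a b → f (a · b) ≡ f a ∙ f b) where
  private
    module SG = Shuffle _·_
    module SH = Shuffle _∙_

  prepend-map : ∀ a (L : List (List G)) → map (f a ∷_) (map (map f) L) ≡ map (map f) (map (a ∷_) L)
  prepend-map a L = trans (sym (map-∘ L)) (map-∘ L)

  shuffles-map      : ∀ u v → SH.shuffles (map f u) (map f v) ≡ map (map f) (SG.shuffles u v)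
  otherShuffles-map : ∀ u v → SH.otherShuffles (map f u) (map f v) ≡ map (map f) (SG.otherShuffles u v)

  shuffles-map [] v = refl
  shuffles-map (a ∷ u) [] = refl
  shuffles-map (a ∷ u) (b ∷ v) = trans
    (cong₂ _++_ (trans (cong (map (f a ∷_)) (shuffles-map u (b ∷ v))) (prepend-map a L))
                (otherShuffles-map (a ∷ u) (b ∷ v)))
    (sym (map-++ (map f) (map (a ∷_) L) (SG.otherShuffles (a ∷ u) (b ∷ v))))
    where
    L : List (List G)
    L = SG.shuffles u (b ∷ v)

  otherShuffles-map [] v = refl
  otherShuffles-map (a ∷ u) [] = refl
  otherShuffles-map (a ∷ u) (b ∷ v) = trans
    (cong₂ _++_ (trans (cong (map (f b ∷_)) (shuffles-map (a ∷ u) v)) (prepend-map b L₁))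
                (trans (cong₂ (λ c L → map (c ∷_) L) (sym (hom a b)) (shuffles-map u v))
                       (prepend-map (a · b) L₂)))
    (sym (map-++ (map f) (map (b ∷_) L₁) (map ((a · b) ∷_) L₂)))
    where
    L₁ : List (List G)
    L₁ = SG.shuffles (a ∷ u) v
    L₂ : List (List G)
    L₂ = SG.shuffles u v

  mapTail : ℕ × List G → ℕ × List H
  mapTail (i , y) = i , map f y

  corrections-map : ∀ p u → SH.corrections (map f p) (map f u) ≡ map mapTail (SG.corrections p u)
  corrections-map [] u = refl
  corrections-map (a ∷ p) u = trans
    (cong₂ (λ C O → map _ C ++ map (0 ,_) O) (corrections-map p u) (otherShuffles-map (a ∷ p) u))
    (trans (cong₂ _++_ (trans (sym (map-∘ C)) (map-∘ C)) (trans (sym (map-∘ O)) (map-∘ O)))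
           (sym (map-++ mapTail (map (λ c → suc (proj₁ c) , proj₂ c) C) (map (0 ,_) O))))
    where
    C : List (ℕ × List G)
    C = SG.corrections p u
    O : List (List G)
    O = SG.otherShuffles (a ∷ p) u

  expand-map : ∀ n p u → SH.expand n (map f p) (map f u) ≡ map (mapTerm f) (SG.expand n p u)
  expand-map zero p u = refl
  expand-map (suc n) p u = cong₂ _∷_ (cong (λ k → term k (ℤ.+ 1) (map f u)) (length-map f p)) (begin
    concatMap FH (SH.corrections (map f p) (map f u)) ≡⟨ cong (concatMap FH) (corrections-map p u) ⟩
    concatMap FH (map mapTail C)                      ≡⟨ concatMap-map FH mapTail C ⟩
    concatMap (FH ∘ mapTail) C                        ≡⟨ concatMap-cong tail-map C ⟩
    concatMap (map (mapTerm f) ∘ FG) C                ≡⟨ map-concatMap (mapTerm f) FG C ⟨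
    map (mapTerm f) (concatMap FG C)                  ∎)
    where
    open ≡-Reasoning
    C : List (ℕ × List G)
    C = SG.corrections p u
    FG : ℕ × List G → List (Term G)
    FG c = map negate (SG.expand n (take (proj₁ c) p) (proj₂ c))
    FH : ℕ × List H → List (Term H)
    FH c = map negate (SH.expand n (take (proj₁ c) (map f p)) (proj₂ c))
    tail-map : ∀ c → FH (mapTail c) ≡ map (mapTerm f) (FG c)
    tail-map (i , y) = begin
      map negate (SH.expand n (take i (map f p)) (map f y)) ≡⟨ cong (λ q → map negate (SH.expand n q (map f y))) (take-map i p) ⟩
      map negate (SH.expand n (map f (take i p)) (map f y)) ≡⟨ cong (map negate) (expand-map n (take i p) y) ⟩
      map negate (map (mapTerm f) E)                          ≡⟨ trans (sym (map-∘ E)) (map-∘ E) ⟩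
      map (mapTerm f) (map negate E)                          ∎
      where
      E : List (Term G)
      E = SG.expand n (take i p) y

ℤ→ℚ-neg : ∀ c → ℤ→ℚ (ℤ.- c) ≡ ℚ.- ℤ→ℚ c
ℤ→ℚ-neg (ℤ.+ zero) = refl
ℤ→ℚ-neg ℤ.+[1+ n ] = refl
ℤ→ℚ-neg ℤ.-[1+ n ] = sym (ℚ-neg-involutive _)

module Semantics {G : Set} (_·_ : G → G → G) (_≟_ : DecidableEquality G) where
  open QuasiShuffle _·_ _≟_
  open Shuffle _·_ hiding (Word)

  coeff-++ : ∀ x y w → coeff (x ++ y) w ≡ coeff x w ℚ.+ coeff y w
  coeff-++ [] y w = sym (ℚP.+-identityˡ _)
  coeff-++ ((c , u) ∷ x) y w with ≡-dec _≟_ u w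
  ... | yes _ = trans (cong (c ℚ.+_) (coeff-++ x y w)) (sym (ℚP.+-assoc c _ _))
  ... | no _ = coeff-++ x y w

  coeff-• : ∀ c x w → coeff (c • x) w ≡ c ℚ.* coeff x w
  coeff-• c [] w = sym (ℚP.*-zeroʳ c)
  coeff-• c ((d , u) ∷ x) w with ≡-dec _≟_ u w
  ... | yes _ = trans (cong (c ℚ.* d ℚ.+_) (coeff-• c x w)) (sym (ℚP.*-distribˡ-+ c d _))
  ... | no _ = coeff-• c x w

  coeff-concatMap : {A : Set} (h : A → Lin) (xs : List A) (w : Word) →
                    coeff (concatMap h xs) w ≡ sumList (λ x → coeff (h x) w) xs
  coeff-concatMap h [] w = refl
  coeff-concatMap h (x ∷ xs) w = trans (coeff-++ (h x) (concatMap h xs) w) (cong (coeff (h x) w ℚ.+_) (coeff-concatMap h xs w))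

  coeff-ΣFin : ∀ N (h : Fin N → Lin) w → coeff (ΣFin N h) w ≡ ∑[ i < N ] coeff (h i) w
  coeff-ΣFin N h w = trans (coeff-concatMap h (allFin N) w) (sumList-tabulate (λ i → coeff (h i) w) (λ i → i))

  sumWords : List Word → Lin
  sumWords = map (1ℚ ,_)

  coeff-sumWords : ∀ L w → coeff (sumWords L) w ≡ sumList (λ v → coeff ⟦ v ⟧ w) L
  coeff-sumWords [] w = refl
  coeff-sumWords (v ∷ L) w = trans (coeff-++ ⟦ v ⟧ (sumWords L) w) (cong (coeff ⟦ v ⟧ w ℚ.+_) (coeff-sumWords L w))

  pre-sumWords : ∀ a L → pre a (sumWords L) ≡ sumWords (map (a ∷_) L)
  pre-sumWords a L = trans (sym (map-∘ L)) (map-∘ L)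

  qsh-shuffles : ∀ u v → qsh u v ≡ sumWords (shuffles u v)
  qsh-shuffles [] v = refl
  qsh-shuffles (a ∷ u) [] = refl
  qsh-shuffles (a ∷ u) (b ∷ v)
    rewrite qsh-shuffles u (b ∷ v) | qsh-shuffles (a ∷ u) v | qsh-shuffles u v = begin
    pre a (sumWords L₁) ++ pre b (sumWords L₂) ++ pre (a · b) (sumWords L₃)
      ≡⟨ cong₂ _++_ (pre-sumWords a L₁) (cong₂ _++_ (pre-sumWords b L₂) (pre-sumWords (a · b) L₃)) ⟩
    sumWords A ++ sumWords B ++ sumWords C
      ≡⟨ cong (sumWords A ++_) (map-++ (1ℚ ,_) B C) ⟨
    sumWords A ++ sumWords (B ++ C)
      ≡⟨ map-++ (1ℚ ,_) A (B ++ C) ⟨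
    sumWords (A ++ B ++ C) ∎
    where
    open ≡-Reasoning
    L₁ : List Word
    L₁ = shuffles u (b ∷ v)
    L₂ : List Word
    L₂ = shuffles (a ∷ u) v
    L₃ : List Word
    L₃ = shuffles u v
    A : List Word
    A = map (a ∷_) L₁
    B : List Word
    B = map (b ∷_) L₂
    C : List Word
    C = map ((a · b) ∷_) L₃

  coeff-product : ∀ u v w → coeff (⟦ u ⟧ * ⟦ v ⟧) w ≡ sumList (λ x → coeff ⟦ x ⟧ w) (shuffles u v)
  coeff-product u v w = begin
    coeff (⟦ u ⟧ * ⟦ v ⟧) w              ≡⟨ cong (λ z → coeff z w) (trans (++-identityʳ (P ++ [])) (++-identityʳ P)) ⟩
    coeff ((1ℚ ℚ.* 1ℚ) • qsh u v) w      ≡⟨ coeff-• (1ℚ ℚ.* 1ℚ) (qsh u v) w ⟩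
    1ℚ ℚ.* coeff (qsh u v) w             ≡⟨ ℚP.*-identityˡ _ ⟩
    coeff (qsh u v) w                    ≡⟨ cong (λ z → coeff z w) (qsh-shuffles u v) ⟩
    coeff (sumWords (shuffles u v)) w    ≡⟨ coeff-sumWords (shuffles u v) w ⟩
    sumList (λ x → coeff ⟦ x ⟧ w) (shuffles u v) ∎
    where
    open ≡-Reasoning
    P : Lin
    P = (1ℚ ℚ.* 1ℚ) • qsh u v

  termValue : Word → Word → Term G → ℚ
  termValue q w t = ℤ→ℚ (coef t) ℚ.* coeff (⟦ take (len t) q ⟧ * ⟦ word t ⟧) w

  termValue-take : ∀ i q w t → len t ≤ i → termValue (take i q) w t ≡ termValue q w t
  termValue-take i q w t len≤i rewrite take-take (len t) i q | ℕP.m≤n⇒m⊓n≡m len≤i = refl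

  termValue-negate : ∀ q w t → termValue q w (negate t) ≡ ℚ.- termValue q w t
  termValue-negate q w t =
    trans (cong (ℚ._* X) (ℤ→ℚ-neg (coef t))) (sym (ℚP.neg-distribˡ-* (ℤ→ℚ (coef t)) X))
    where
    X : ℚ
    X = coeff (⟦ take (len t) q ⟧ * ⟦ word t ⟧) w

  expand-correct : ∀ n p u → length p < n → ∀ w →
                   coeff ⟦ p ++ u ⟧ w ≡ sumList (termValue p w) (expand n p u)
  expand-correct (suc n) p u (s≤s p≤n) w = sym (begin
    termValue p w (term (length p) (ℤ.+ 1) u) ℚ.+ sumList (termValue p w) (concatMap F C)
      ≡⟨ cong₂ ℚ._+_ leading corrected ⟩
    (V (p ++ u) ℚ.+ K) ℚ.+ ℚ.- K       ≡⟨ ℚP.+-assoc (V (p ++ u)) K (ℚ.- K) ⟩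
    V (p ++ u) ℚ.+ (K ℚ.+ ℚ.- K)       ≡⟨ cong (V (p ++ u) ℚ.+_) (ℚP.+-inverseʳ K) ⟩
    V (p ++ u) ℚ.+ 0ℚ                  ≡⟨ ℚP.+-identityʳ (V (p ++ u)) ⟩
    V (p ++ u)                         ∎)
    where
    open ≡-Reasoning
    V : Word → ℚ
    V x = coeff ⟦ x ⟧ w
    C : List (ℕ × Word)
    C = corrections p u
    F : ℕ × Word → List (Term G)
    F c = map negate (expand n (take (proj₁ c) p) (proj₂ c))
    K : ℚ
    K = sumList (V ∘ splice p) C

    -- the leading term is p * u = p ++ u + Σ corrections
    leading : termValue p w (term (length p) (ℤ.+ 1) u) ≡ V (p ++ u) ℚ.+ K
    leading = begin
      1ℚ ℚ.* coeff (⟦ take (length p) p ⟧ * ⟦ u ⟧) w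
        ≡⟨ ℚP.*-identityˡ _ ⟩
      coeff (⟦ take (length p) p ⟧ * ⟦ u ⟧) w
        ≡⟨ cong (λ q → coeff (⟦ q ⟧ * ⟦ u ⟧) w) (take-all (length p) p ℕP.≤-refl) ⟩
      coeff (⟦ p ⟧ * ⟦ u ⟧) w
        ≡⟨ coeff-product p u w ⟩
      sumList V (shuffles p u)
        ≡⟨ cong (sumList V) (shuffles-decompose p u) ⟩
      V (p ++ u) ℚ.+ sumList V (map (splice p) C)
        ≡⟨ cong (V (p ++ u) ℚ.+_) (sumList-map V (splice p) C) ⟩
      V (p ++ u) ℚ.+ K ∎

    -- by induction, each correction is cancelled by its own expansion
    cancel : ∀ c → proj₁ c < length p → sumList (termValue p w) (F c) ≡ ℚ.- V (splice p c)
    cancel (i , y) i<p = begin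
      sumList (termValue p w) (map negate E)            ≡⟨ sumList-map (termValue p w) negate E ⟩
      sumList (termValue p w ∘ negate) E                ≡⟨ sumList-cong (All.universal (termValue-negate p w) E) ⟩
      sumList (ℚ.-_ ∘ termValue p w) E                  ≡⟨ sumList-neg (termValue p w) E ⟩
      ℚ.- sumList (termValue p w) E                     ≡⟨ cong ℚ.-_ (sumList-cong (All.map (λ {t} → shorter t) (expand-bounded n (take i p) y))) ⟨
      ℚ.- sumList (termValue (take i p) w) E            ≡⟨ cong ℚ.-_ (expand-correct n (take i p) y prefix<n w) ⟨
      ℚ.- V (take i p ++ y)                             ∎
      where
      E : List (Term G)
      E = expand n (take i p) y
      shorter : ∀ t → len t ≤ length (take i p) → termValue (take i p) w t ≡ termValue p w t
      shorter t t≤ = termValue-take i p w t (ℕP.≤-trans t≤ (length-take-≤ i p))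
      prefix<n : length (take i p) < n
      prefix<n = ℕP.≤-<-trans (length-take-≤ i p) (ℕP.<-≤-trans i<p p≤n)

    corrected : sumList (termValue p w) (concatMap F C) ≡ ℚ.- K
    corrected = begin
      sumList (termValue p w) (concatMap F C)           ≡⟨ sumList-concatMap (termValue p w) F C ⟩
      sumList (sumList (termValue p w) ∘ F) C           ≡⟨ sumList-cong (All.map (λ {c} → cancel c) (corrections-bounded p u)) ⟩
      sumList (ℚ.-_ ∘ V ∘ splice p) C                   ≡⟨ sumList-neg (V ∘ splice p) C ⟩
      ℚ.- K                                             ∎

  -- The
  -- prefixes [take i q] and the slot words may be given in any form equal to them.
  regroup : ∀ ℓ n (g : Fin n → Term G) (pre : ℕ → Word) (W : Fin (suc n) → Word) q w →
            (∀ j → len (g j) ≤ ℓ) → (∀ i → i ≤ ℓ → pre i ≡ take i q) →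
            (∀ j → W (fsuc j) ≡ word (g j)) →
            coeff (ΣFin (suc ℓ) (λ i → ΣFin (suc n) (λ j →
              ℤ→ℚ (slotCoef (shape ∘ g) i j) • (⟦ pre (toℕ i) ⟧ * ⟦ W j ⟧)))) w
            ≡ ∑[ j < n ] termValue q w (g j)
  regroup ℓ n g pre W q w bounded prefix slot = begin
    coeff (ΣFin (suc ℓ) (λ i → ΣFin (suc n) (summand i))) w
      ≡⟨ coeff-ΣFin (suc ℓ) (λ i → ΣFin (suc n) (summand i)) w ⟩
    ∑[ i < suc ℓ ] coeff (ΣFin (suc n) (summand i)) w
      ≡⟨ sum-cong-≗ (λ i → coeff-ΣFin (suc n) (summand i) w) ⟩
    ∑[ i < suc ℓ ] ∑[ j < suc n ] coeff (summand i j) w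
      ≡⟨ sum-cong-≗ (λ i → cong₂ ℚ._+_ (dummy i) (sum-cong-≗ (selected i))) ⟩
    ∑[ i < suc ℓ ] (0ℚ ℚ.+ ∑[ j < n ] δ i j)
      ≡⟨ sum-cong-≗ (λ i → ℚP.+-identityˡ (∑[ j < n ] δ i j)) ⟩
    ∑[ i < suc ℓ ] ∑[ j < n ] δ i j
      ≡⟨ ∑-comm δ ⟩
    ∑[ j < n ] ∑[ i < suc ℓ ] δ i j
      ≡⟨ sum-cong-≗ (λ j → sum-delta ℓ (len (g j)) (termValue q w (g j)) (bounded j)) ⟩
    ∑[ j < n ] termValue q w (g j) ∎
    where
    open ≡-Reasoning
    summand : Fin (suc ℓ) → Fin (suc n) → Lin
    summand i j = ℤ→ℚ (slotCoef (shape ∘ g) i j) • (⟦ pre (toℕ i) ⟧ * ⟦ W j ⟧)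
    δ : Fin (suc ℓ) → Fin n → ℚ
    δ i j = if len (g j) ℕ.≡ᵇ toℕ i then termValue q w (g j) else 0ℚ

    vanishes : ∀ x → coeff (0ℚ • x) w ≡ 0ℚ
    vanishes x = trans (coeff-• 0ℚ x w) (ℚP.*-zeroˡ (coeff x w))

    dummy : ∀ i → coeff (summand i fzero) w ≡ 0ℚ
    dummy i = vanishes (⟦ pre (toℕ i) ⟧ * ⟦ W fzero ⟧)

    selected : ∀ i j → coeff (summand i (fsuc j)) w ≡ δ i j
    selected i j with len (g j) ℕ.≡ᵇ toℕ i in len≡ᵇi
    ... | false = vanishes (⟦ pre (toℕ i) ⟧ * ⟦ W (fsuc j) ⟧)
    ... | true = trans (coeff-• (ℤ→ℚ (coef (g j))) (⟦ pre (toℕ i) ⟧ * ⟦ W (fsuc j) ⟧) w)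
                       (cong (λ x → ℤ→ℚ (coef (g j)) ℚ.* coeff x w)
                             (cong₂ (λ a b → ⟦ a ⟧ * ⟦ b ⟧) prefix-i (slot j)))
      where
      prefix-i : pre (toℕ i) ≡ take (len (g j)) q
      prefix-i = trans (prefix (toℕ i) (FinP.toℕ≤pred[n] i))
                       (cong (λ k → take k q) (sym (ℕP.≡ᵇ⇒≡ (len (g j)) (toℕ i) (subst T (sym len≡ᵇi) tt))))

  expansion : ∀ ℓ p u (pre : ℕ → Word) → length p ≡ ℓ → (∀ i → i ≤ ℓ → pre i ≡ take i p) →
              let g = lookup (expand (suc ℓ) p u) in
              ⟦ p ++ u ⟧ ≈ ΣFin (suc ℓ) (λ i → ΣFin (suc (length (expand (suc ℓ) p u))) (λ j →
                             ℤ→ℚ (slotCoef (shape ∘ g) i j) • (⟦ pre (toℕ i) ⟧ * ⟦ slotWord g u j ⟧)))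
  expansion ℓ p u pre refl prefix w = begin
    coeff ⟦ p ++ u ⟧ w                                ≡⟨ expand-correct (suc ℓ) p u ℕP.≤-refl w ⟩
    sumList (termValue p w) E                         ≡⟨ sumList-lookup (termValue p w) E ⟩
    ∑[ j < length E ] termValue p w (lookup E j)      ≡⟨ regroup ℓ (length E) (lookup E) pre (slotWord (lookup E) u) p w
                                                           bounded prefix (λ _ → refl) ⟨
    coeff (ΣFin (suc ℓ) (λ i → ΣFin (suc (length E)) (λ j →
      ℤ→ℚ (slotCoef (shape ∘ lookup E) i j) • (⟦ pre (toℕ i) ⟧ * ⟦ slotWord (lookup E) u j ⟧)))) w ∎
    where
    open ≡-Reasoning
    E : List (Term G)
    E = expand (suc ℓ) p u
    bounded : ∀ j → len (lookup E j) ≤ length p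
    bounded j = All.lookup (expand-bounded (suc ℓ) p u) (∈-lookup j)

Admissible : List ℕ → Set
Admissible y = AllPos y × HeadGt1 y

module ℕShuffle = Shuffle ℕ._+_
open ℕShuffle using (shuffles; otherShuffles; corrections; expand)

1≤+ : ∀ {a} b → 1 ≤ a → 1 ≤ a ℕ.+ b
1≤+ {a} b 1≤a = ℕP.≤-trans 1≤a (ℕP.m≤m+n a b)

take-pos : ∀ i {p} → AllPos p → AllPos (take i p)
take-pos zero _ = []
take-pos (suc i) [] = []
take-pos (suc i) (1≤a ∷ pos) = 1≤a ∷ take-pos i pos

shuffles-pos : ∀ {x y} → AllPos x → AllPos y → All AllPos (shuffles x y)
shuffles-pos {[]} _ pos-y = pos-y ∷ []
shuffles-pos {a ∷ x} {[]} pos-x _ = pos-x ∷ []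
shuffles-pos {a ∷ x} {b ∷ y} (1≤a ∷ pos-x) (1≤b ∷ pos-y) =
  AllP.++⁺ (AllP.map⁺ (All.map (1≤a ∷_) (shuffles-pos pos-x (1≤b ∷ pos-y))))
  (AllP.++⁺ (AllP.map⁺ (All.map (1≤b ∷_) (shuffles-pos (1≤a ∷ pos-x) pos-y)))
            (AllP.map⁺ (All.map (1≤+ b 1≤a ∷_) (shuffles-pos pos-x pos-y))))

-- If the right word is admissible, every quasi-shuffle not starting with a
-- letter of the left word alone starts with b or a + b, hence is admissible.
otherShuffles-admissible : ∀ {x y} → AllPos x → Admissible y → All Admissible (otherShuffles x y)
otherShuffles-admissible {[]} _ _ = []
otherShuffles-admissible {a ∷ x} {b ∷ y} (1≤a ∷ pos-x) (1≤b ∷ pos-y , 1<b) =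
  AllP.++⁺ (AllP.map⁺ (All.map (λ pos → (1≤b ∷ pos) , 1<b) (shuffles-pos (1≤a ∷ pos-x) pos-y)))
           (AllP.map⁺ (All.map (λ pos → (1≤+ b 1≤a ∷ pos) , ℕP.≤-trans 1<b (ℕP.m≤n+m b a))
                                (shuffles-pos pos-x pos-y)))

corrections-admissible : ∀ {p u} → AllPos p → Admissible u → All (Admissible ∘ proj₂) (corrections p u)
corrections-admissible {[]} _ _ = []
corrections-admissible {a ∷ p} (1≤a ∷ pos-p) adm-u =
  AllP.++⁺ (AllP.map⁺ (corrections-admissible pos-p adm-u))
           (AllP.map⁺ (otherShuffles-admissible (1≤a ∷ pos-p) adm-u))

expand-admissible : ∀ n {p u} → AllPos p → Admissible u → All (Admissible ∘ word) (expand n p u)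
expand-admissible zero _ _ = []
expand-admissible (suc n) {p} pos-p adm-u = adm-u ∷
  AllP.concat⁺ (AllP.map⁺ (All.map (λ {c} adm-c → AllP.map⁺ (expand-admissible n (take-pos (proj₁ c) pos-p) adm-c))
                                   (corrections-admissible pos-p adm-u)))

proj₁-arr : ∀ xs ys → length xs ≡ length ys → map proj₁ (arr xs ys) ≡ map (ℤ.+_) xs
proj₁-arr [] [] _ = refl
proj₁-arr (x ∷ xs) (y ∷ ys) e = cong (ℤ.+ x ∷_) (proj₁-arr xs ys (ℕP.suc-injective e))

arr-bottom : ∀ xs (zs : List (ℤ × ℕ)) → map proj₁ zs ≡ map (ℤ.+_) xs → arr xs (map proj₂ zs) ≡ zs
arr-bottom [] [] _ = refl
arr-bottom (x ∷ xs) ((a , b) ∷ zs) e =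
  cong₂ _∷_ (cong (_, b) (sym (proj₁ (∷-injective e)))) (arr-bottom xs zs (proj₂ (∷-injective e)))

arr-++ : ∀ xs ys xs' ys' → length xs ≡ length ys → arr (xs ++ xs') (ys ++ ys') ≡ arr xs ys ++ arr xs' ys'
arr-++ [] [] xs' ys' _ = refl
arr-++ (x ∷ xs) (y ∷ ys) xs' ys' e = cong (_ ∷_) (arr-++ xs ys xs' ys' (ℕP.suc-injective e))

length-arr-≤ : ∀ xs ys → length (arr xs ys) ≤ length xs
length-arr-≤ xs ys = subst (_≤ length xs) (sym (length-zipWith (λ a b → (ℤ.+ a , b)) xs ys)) (ℕP.m⊓n≤m (length xs) (length ys))

take-arr : ∀ i xs ys → take i (arr xs ys) ≡ arr (take i xs) (take i ys)
take-arr zero xs ys = refl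
take-arr (suc i) [] ys = refl
take-arr (suc i) (x ∷ xs) [] = refl
take-arr (suc i) (x ∷ xs) (y ∷ ys) = cong (_ ∷_) (take-arr i xs ys)

take-ones : ∀ {i ℓ} → i ≤ ℓ → take i (ones ℓ) ≡ ones i
take-ones {zero} _ = refl
take-ones {suc i} {suc ℓ} (s≤s i≤ℓ) = cong (1 ∷_) (take-ones i≤ℓ)

ones-pos : ∀ n → AllPos (ones n)
ones-pos zero = []
ones-pos (suc n) = s≤s z≤n ∷ ones-pos n

-- Both ℤ_{≥1} ↪ ℤ and the projection M → ℤ are
-- homomorphisms, so by naturality the expansion of an array lies termwise
-- over the expansion of its top row: same prefix lengths and coefficients,
-- and words whose top rows are the words of the ℕ-expansion.
module MShuffle = Shuffle _+M_
module MSemantics = Semantics _+M_ (×P.≡-dec ℤP._≟_ ℕP._≟_)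
module ℕ→ℤ = Naturality ℕ._+_ ℤ._+_ ℤ.+_ (λ _ _ → refl)
module M→ℤ = Naturality _+M_ ℤ._+_ proj₁ (λ _ _ → refl)

Lifts : Term ℕ → Term (ℤ × ℕ) → Set
Lifts t t' = mapTerm (ℤ.+_) t ≡ mapTerm proj₁ t'

lift-arr : ∀ {t t'} → Lifts t t' → t' ≡ term (len t) (coef t) (arr (word t) (map proj₂ (word t')))
lift-arr {term i c y} {term i' c' y'} e with cong len e | cong coef e
... | refl | refl = cong (term i c) (sym (arr-bottom y y' (sym (cong word e))))

expand-lifts : ∀ n xs ys us vs → length xs ≡ length ys → length us ≡ length vs →
               Pointwise Lifts (expand n xs us) (MShuffle.expand n (arr xs ys) (arr us vs))
expand-lifts n xs ys us vs xs≡ys us≡vs =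
  Pointwise.map⁻ (mapTerm (ℤ.+_)) (mapTerm proj₁) (Pointwise.≡⇒Pointwise-≡ (begin
    map (mapTerm (ℤ.+_)) (expand n xs us)
      ≡⟨ ℕ→ℤ.expand-map n xs us ⟨
    ℤShuffle.expand n (map (ℤ.+_) xs) (map (ℤ.+_) us)
      ≡⟨ cong₂ (ℤShuffle.expand n) (proj₁-arr xs ys xs≡ys) (proj₁-arr us vs us≡vs) ⟨
    ℤShuffle.expand n (map proj₁ (arr xs ys)) (map proj₁ (arr us vs))
      ≡⟨ M→ℤ.expand-map n (arr xs ys) (arr us vs) ⟩
    map (mapTerm proj₁) (MShuffle.expand n (arr xs ys) (arr us vs)) ∎))
  where
  open ≡-Reasoning
  module ℤShuffle = Shuffle ℤ._+_

expansion-lift : ∀ ℓ xs us ys vs (pre : ℕ → List (ℤ × ℕ)) →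
  length xs ≡ ℓ → length xs ≡ length ys → length us ≡ length vs →
  (∀ i → i ≤ ℓ → pre i ≡ take i (arr xs ys)) →
  let E = expand (suc ℓ) xs us ; g = lookup E in
  Σ (Fin (suc (length E)) → List ℕ) λ rows →
    (∀ j → length (rows j) ≡ length (slotWord g us j)) ×
    (HM.⟦ arr (xs ++ us) (ys ++ vs) ⟧ HM.≈ HM.ΣFin (suc ℓ) (λ i → HM.ΣFin (suc (length E)) (λ j →
       ℤ→ℚ (slotCoef (shape ∘ g) i j) HM.• (HM.⟦ pre (toℕ i) ⟧ HM.* HM.⟦ arr (slotWord g us j) (rows j) ⟧))))
expansion-lift ℓ xs us ys vs pre refl xs≡ys us≡vs prefix = rows , rows-length , identity
  where
  open MSemantics using (termValue; expand-correct; regroup)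
  E : List (Term ℕ)
  E = expand (suc ℓ) xs us
  EM : List (Term (ℤ × ℕ))
  EM = MShuffle.expand (suc ℓ) (arr xs ys) (arr us vs)
  g : Fin (length E) → Term ℕ
  g = lookup E
  lifts : Pointwise Lifts E EM
  lifts = expand-lifts (suc ℓ) xs ys us vs xs≡ys us≡vs
  over : Fin (length E) → Term (ℤ × ℕ)
  over j = lookup EM (cast (Pointwise-length lifts) j)
  rows : Fin (suc (length E)) → List ℕ
  rows fzero = vs
  rows (fsuc j) = map proj₂ (word (over j))
  rows-length : ∀ j → length (rows j) ≡ length (slotWord g us j)
  rows-length fzero = sym us≡vs
  rows-length (fsuc j) = begin
    length (map proj₂ (word (over j)))   ≡⟨ length-map proj₂ (word (over j)) ⟩
    length (word (over j))               ≡⟨ length-map proj₁ (word (over j)) ⟨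
    length (map proj₁ (word (over j)))   ≡⟨ cong (length ∘ word) (Pointwise.lookup⁺ lifts j) ⟨
    length (map (ℤ.+_) (word (g j)))     ≡⟨ length-map (ℤ.+_) (word (g j)) ⟩
    length (word (g j))                  ∎
    where open ≡-Reasoning
  gM : Fin (length E) → Term (ℤ × ℕ)
  gM j = term (len (g j)) (coef (g j)) (arr (word (g j)) (rows (fsuc j)))
  bounded : ∀ j → len (gM j) ≤ length xs
  bounded j = All.lookup (ℕShuffle.expand-bounded (suc ℓ) xs us) (∈-lookup j)
  identity : HM.⟦ arr (xs ++ us) (ys ++ vs) ⟧ HM.≈ HM.ΣFin (suc ℓ) (λ i → HM.ΣFin (suc (length E)) (λ j →
               ℤ→ℚ (slotCoef (shape ∘ g) i j) HM.• (HM.⟦ pre (toℕ i) ⟧ HM.* HM.⟦ arr (slotWord g us j) (rows j) ⟧)))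
  identity w = begin
    HM.coeff HM.⟦ arr (xs ++ us) (ys ++ vs) ⟧ w          ≡⟨ cong (λ z → HM.coeff HM.⟦ z ⟧ w) (arr-++ xs ys us vs xs≡ys) ⟩
    HM.coeff HM.⟦ arr xs ys ++ arr us vs ⟧ w             ≡⟨ expand-correct (suc ℓ) (arr xs ys) (arr us vs) (s≤s (length-arr-≤ xs ys)) w ⟩
    sumList (termValue (arr xs ys) w) EM                 ≡⟨ sumList-lookup-cast (termValue (arr xs ys) w) E EM (Pointwise-length lifts) ⟩
    ∑[ j < length E ] termValue (arr xs ys) w (over j)   ≡⟨ sum-cong-≗ (λ j → cong (termValue (arr xs ys) w) (lift-arr (Pointwise.lookup⁺ lifts j))) ⟩
    ∑[ j < length E ] termValue (arr xs ys) w (gM j)     ≡⟨ regroup ℓ (length E) gM pre (λ j → arr (slotWord g us j) (rows j)) (arr xs ys) w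
                                                             bounded prefix (λ _ → refl) ⟨
    HM.coeff (HM.ΣFin (suc ℓ) (λ i → HM.ΣFin (suc (length E)) (λ j →
       ℤ→ℚ (slotCoef (shape ∘ g) i j) HM.• (HM.⟦ pre (toℕ i) ⟧ HM.* HM.⟦ arr (slotWord g us j) (rows j) ⟧)))) w ∎
    where open ≡-Reasoning

module ℕSemantics = Semantics ℕ._+_ ℕP._≟_

lemma4p11 : (ℓ k : ℕ) → 1 ≤ ℓ → 1 ≤ k →
    (s : List ℕ) → length s ≡ k → AllPos s → HeadGt1 s →
    Σ (Fin (suc ℓ) → ℕ) λ m → (∀ i → 1 ≤ m i) ×
    Σ ((i : Fin (suc ℓ)) → Fin (m i) → ℤ) λ a →
    Σ ((i : Fin (suc ℓ)) → Fin (m i) → List ℕ) λ S →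
    (∀ i j → AllPos (S i j) × HeadGt1 (S i j)) ×
    (H≥1.⟦ ones ℓ ++ s ⟧ H≥1.≈
      H≥1.ΣFin (suc ℓ) (λ i → H≥1.ΣFin (m i) (λ j →
        ℤ→ℚ (a i j) H≥1.• (H≥1.⟦ ones (toℕ i) ⟧ H≥1.* H≥1.⟦ S i j ⟧)))) ×
    ((p r : List ℕ) → length p ≡ ℓ → length r ≡ k →
      Σ ((i : Fin (suc ℓ)) → Fin (m i) → List ℕ) λ R →
      (∀ i j → length (R i j) ≡ length (S i j)) ×
      (HM.⟦ arr (ones ℓ ++ s) (p ++ r) ⟧ HM.≈
        HM.ΣFin (suc ℓ) (λ i → HM.ΣFin (m i) (λ j →
          ℤ→ℚ (a i j) HM.• (HM.⟦ arr (ones (toℕ i)) (take (toℕ i) p) ⟧ HM.* HM.⟦ arr (S i j) (R i j) ⟧)))))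
lemma4p11 ℓ k _ _ s refl pos-s head-s =
  (λ _ → suc (length E)) , (λ _ → s≤s z≤n) , (λ i → slotCoef (shape ∘ g) i) , (λ _ → slotWord g s) ,
  (λ _ → admissible) ,
  ℕSemantics.expansion ℓ (ones ℓ) s ones ones-length (λ _ i≤ℓ → sym (take-ones i≤ℓ)) ,
  λ p r p≡ℓ r≡k →
    Product.map (λ rows _ → rows) (Product.map₁ (λ rows-length _ → rows-length))
      (expansion-lift ℓ (ones ℓ) s p r (λ i → arr (ones i) (take i p))
         ones-length (trans ones-length (sym p≡ℓ)) (sym r≡k) (prefix p))
  where
  E : List (Term ℕ)
  E = expand (suc ℓ) (ones ℓ) s
  g : Fin (length E) → Term ℕ
  g = lookup E
  ones-length : length (ones ℓ) ≡ ℓ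
  ones-length = length-replicate ℓ
  admissible : ∀ j → Admissible (slotWord g s j)
  admissible fzero = pos-s , head-s
  admissible (fsuc j) = All.lookup (expand-admissible (suc ℓ) (ones-pos ℓ) (pos-s , head-s)) (∈-lookup j)
  prefix : ∀ p i → i ≤ ℓ → arr (ones i) (take i p) ≡ take i (arr (ones ℓ) p)
  prefix p i i≤ℓ = sym (trans (take-arr i (ones ℓ) p) (cong (λ o → arr o (take i p)) (take-ones i≤ℓ)))
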